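{- There is an infinite family $F$ of patterns (strings over a finite alphabet $\Sigma$) such that, for every $P\in F$, any deterministic finite automaton $A_P$ accepting the language $L_S(P)=\{u\,\pi(P)\mid u\in\Sigma^*,\ \pi \text{ is a swap permutation for } P\}$ has $2^{\Omega(|P|)}$ states.
   Context: For a string $S=S_1\cdots S_n$, a swap permutation for $S$ is a permutation $\pi$ of $\{1,\dots,n\}$ such that (i) $\pi(i)=j$ implies $\pi(j)=i$; (ii) $\pi(i)\in\{i-1,i,i+1\}$ for all $i$; (iii) if $\pi(i)\neq i$ then $S_{\pi(i)}\neq S_i$. The swapped version is $\pi(S)=S_{\pi(1)}S_{\pi(2)}\cdots S_{\pi(n)}$. -}

module Defs where

open import Data.Nat using (ℕ; zero; suc)
open import Data.Fin using (Fin; toℕ)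
open import Data.List using (List; []; _∷_; _++_; length; lookup; tabulate)
open import Data.Bool using (Bool; true)
open import Data.Product using (Σ; ∃; _×_; _,_)
open import Data.Sum using (_⊎_)
open import Relation.Binary.PropositionalEquality using (_≡_; _≢_)
open import Function.Bundles using (_⇔_)

Word : ℕ → Set
Word m = List (Fin m)

-- A swap permutation for S (conditions (i)–(iii) of the paper).
-- Condition (i) (involution) also implies that π is a permutation.
record IsSwapPerm {m : ℕ} (S : Word m) (π : Fin (length S) → Fin (length S)) : Set where
  field
    involutive : ∀ i → π (π i) ≡ i
    adjacent   : ∀ i → (toℕ (π i) ≡ toℕ i) ⊎ (toℕ (π i) ≡ suc (toℕ i)) ⊎ (suc (toℕ (π i)) ≡ toℕ i)
    distinct   : ∀ i → π i ≢ i → lookup S (π i) ≢ lookup S i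

swapped : {m : ℕ} (S : Word m) → (Fin (length S) → Fin (length S)) → Word m
swapped S π = tabulate (λ i → lookup S (π i))

LS : {m : ℕ} → Word m → Word m → Set
LS P w = Σ (Word _) λ u → Σ (Fin (length P) → Fin (length P)) λ π →
           IsSwapPerm P π × (w ≡ u ++ swapped P π)

record DFA (m : ℕ) : Set where
  field
    nStates : ℕ
    start   : Fin nStates
    δ       : Fin nStates → Fin m → Fin nStates
    final   : Fin nStates → Bool

  run : Fin nStates → Word m → Fin nStates
  run q []       = q
  run q (a ∷ w)  = run (δ q a) w

  Accepts : Word m → Set
  Accepts w = final (run start w) ≡ true

open DFA public

Recognizes : {m : ℕ} → DFA m → (Word m → Set) → Set
Recognizes A L = ∀ w → Accepts A w ⇔ L w

-- Take P_M = a (ab)^M over {a, b}. For f : Fin M → {a, b} let w_f = c_0 ⋯ c_(M-1), where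
-- the block c_i is ba if f i = a and ab if f i = b. In w_f (ab)^(i+1) the last |P_M| = 2M+1
-- letters start at the second letter of c_i. If c_i = ba they form a followed by a swap of
-- (ab)^M, a swapped version of P_M; if c_i = ab they start with b, whereas every swapped
-- version of P_M starts with a because its first two letters are equal. Hence the 2^M words
-- w_f are pairwise Myhill–Nerode inequivalent for L_S(P_M), a DFA for it has at least 2^M
-- states, and 2^(2M+1) ≤ (2^M)^3.
module Submission where

open import Defs
import Data.Nat as ℕ
open ℕ using (ℕ; zero; suc; _≤_; _^_; _+_; _*_; z≤n; s≤s)
open import Data.Nat.Properties
  using (+-comm; +-suc; +-identityʳ; *-comm; +-monoˡ-≤; ^-monoʳ-≤; ^-monoˡ-≤; ^-*-assoc; suc-injective; module ≤-Reasoning)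
open import Data.List using (List; []; _∷_; [_]; _++_; length; lookup)
open import Data.List.Properties using (length-tabulate; ++-assoc; ∷-injectiveˡ; ∷-injectiveʳ)
open import Data.List.Relation.Binary.Pointwise using (Pointwise-≡⇒≡; ≡⇒Pointwise-≡)
open import Data.List.Relation.Binary.Suffix.Heterogeneous using (here)
import Data.List.Relation.Binary.Suffix.Heterogeneous.Properties as Suffix
import Data.Fin as Fin
open Fin using (Fin; zero; suc; toℕ; finToFun; funToFin; combine)
open import Data.Fin.Properties using (injective⇒≤; funToFin-finToFin)
open import Data.Product using (Σ; _×_; _,_)
open import Data.Sum using (_⊎_; inj₁; inj₂)
import Data.Sum as Sum
open import Function using (_∘_)
open import Function.Definitions using (Injective)
open import Function.Bundles using (_⇔_; mk⇔; Equivalence)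
open import Function.Construct.Composition using (_⇔-∘_)
open import Function.Construct.Symmetry using (⇔-sym)
open import Data.Empty using (⊥-elim)
open import Data.Bool using (true)
open import Relation.Nullary using (¬_)
open import Relation.Binary.PropositionalEquality
  using (_≡_; _≢_; _≗_; refl; sym; trans; cong; cong₂; subst; module ≡-Reasoning)

++-cancelˡ-sameLength : ∀ {A : Set} {u u′ v v′ : List A} →
                        length v ≡ length v′ → u ++ v ≡ u′ ++ v′ → v ≡ v′
++-cancelˡ-sameLength len eq = Pointwise-≡⇒≡ (Suffix.++⁻ len (here (≡⇒Pointwise-≡ eq)))

data Swap {A : Set} : List A → List A → Set where
  []   : Swap [] []
  keep : ∀ x {S T} → Swap S T → Swap (x ∷ S) (x ∷ T)
  swap : ∀ {x y S T} → x ≢ y → Swap S T → Swap (x ∷ y ∷ S) (y ∷ x ∷ T)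

Swap-refl : ∀ {A : Set} (S : List A) → Swap S S
Swap-refl []      = []
Swap-refl (x ∷ S) = keep x (Swap-refl S)

Swap-++ : ∀ {A : Set} {S S′ T T′ : List A} → Swap S T → Swap S′ T′ → Swap (S ++ S′) (T ++ T′)
Swap-++ []           s′ = s′
Swap-++ (keep x s)   s′ = keep x (Swap-++ s s′)
Swap-++ (swap x≢y s) s′ = swap x≢y (Swap-++ s s′)

Swap-length : ∀ {A : Set} {S T : List A} → Swap S T → length S ≡ length T
Swap-length []           = refl
Swap-length (keep x s)   = cong ℕ.suc (Swap-length s)
Swap-length (swap x≢y s) = cong (ℕ.suc ∘ ℕ.suc) (Swap-length s)

fixHead : ∀ {n} → (Fin n → Fin n) → Fin (suc n) → Fin (suc n)
fixHead π zero    = zero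
fixHead π (suc i) = suc (π i)

swapHead : ∀ {n} → (Fin n → Fin n) → Fin (suc (suc n)) → Fin (suc (suc n))
swapHead π zero          = suc zero
swapHead π (suc zero)    = zero
swapHead π (suc (suc i)) = suc (suc (π i))

adjacent-suc : ∀ {j i} → (j ≡ i) ⊎ (j ≡ suc i) ⊎ (suc j ≡ i) →
               (suc j ≡ suc i) ⊎ (suc j ≡ suc (suc i)) ⊎ (suc (suc j) ≡ suc i)
adjacent-suc = Sum.map (cong ℕ.suc) (Sum.map (cong ℕ.suc) (cong ℕ.suc))

module _ {m : ℕ} where

  open IsSwapPerm

  fixHead-isSwapPerm : ∀ {x} {S : Word m} {π} → IsSwapPerm S π → IsSwapPerm (x ∷ S) (fixHead π)
  fixHead-isSwapPerm isπ .involutive zero          = refl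
  fixHead-isSwapPerm isπ .involutive (suc i)       = cong Fin.suc (involutive isπ i)
  fixHead-isSwapPerm isπ .adjacent   zero          = inj₁ refl
  fixHead-isSwapPerm isπ .adjacent   (suc i)       = adjacent-suc (adjacent isπ i)
  fixHead-isSwapPerm isπ .distinct   zero    π0≢0  = λ _ → π0≢0 refl
  fixHead-isSwapPerm isπ .distinct   (suc i) πi≢i  = distinct isπ i (πi≢i ∘ cong Fin.suc)

  swapHead-isSwapPerm : ∀ {x y} {S : Word m} {π} → x ≢ y → IsSwapPerm S π →
                        IsSwapPerm (x ∷ y ∷ S) (swapHead π)
  swapHead-isSwapPerm x≢y isπ .involutive zero          = refl
  swapHead-isSwapPerm x≢y isπ .involutive (suc zero)    = refl
  swapHead-isSwapPerm x≢y isπ .involutive (suc (suc i)) = cong (Fin.suc ∘ Fin.suc) (involutive isπ i)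
  swapHead-isSwapPerm x≢y isπ .adjacent   zero          = inj₂ (inj₁ refl)
  swapHead-isSwapPerm x≢y isπ .adjacent   (suc zero)    = inj₂ (inj₂ refl)
  swapHead-isSwapPerm x≢y isπ .adjacent   (suc (suc i)) = adjacent-suc (adjacent-suc (adjacent isπ i))
  swapHead-isSwapPerm x≢y isπ .distinct   zero          _    = x≢y ∘ sym
  swapHead-isSwapPerm x≢y isπ .distinct   (suc zero)    _    = x≢y
  swapHead-isSwapPerm x≢y isπ .distinct   (suc (suc i)) πi≢i = distinct isπ i (πi≢i ∘ cong (Fin.suc ∘ Fin.suc))

  Swap⇒swapPerm : ∀ {S T : Word m} → Swap S T →
                  Σ (Fin (length S) → Fin (length S)) λ π → IsSwapPerm S π × swapped S π ≡ T
  Swap⇒swapPerm [] = (λ ()) , record { involutive = λ () ; adjacent = λ () ; distinct = λ () } , refl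
  Swap⇒swapPerm (keep x s) with Swap⇒swapPerm s
  ... | π , isπ , eq = fixHead π , fixHead-isSwapPerm isπ , cong (x ∷_) eq
  Swap⇒swapPerm (swap {x} {y} x≢y s) with Swap⇒swapPerm s
  ... | π , isπ , eq = swapHead π , swapHead-isSwapPerm x≢y isπ , cong (λ T → y ∷ x ∷ T) eq

  -- π 0 ∈ {0, 1} by adjacency, and both positions carry x.
  swapPerm-head : ∀ {x} {S : Word m} {π} → IsSwapPerm (x ∷ x ∷ S) π → lookup (x ∷ x ∷ S) (π zero) ≡ x
  swapPerm-head {π = π} isπ with π zero | adjacent isπ zero
  ... | zero        | _              = refl
  ... | suc zero    | _              = refl
  ... | suc (suc _) | inj₁ ()
  ... | suc (suc _) | inj₂ (inj₁ ())
  ... | suc (suc _) | inj₂ (inj₂ ())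

  LS-intro : ∀ {P T : Word m} (u : Word m) → Swap P T → LS P (u ++ T)
  LS-intro u s with Swap⇒swapPerm s
  ... | π , isπ , eq = u , π , isπ , cong (u ++_) (sym eq)

  LS-suffix : ∀ {P v T : Word m} → LS P (v ++ T) → length T ≡ length P →
              Σ (Fin (length P) → Fin (length P)) λ π → IsSwapPerm P π × T ≡ swapped P π
  LS-suffix {P} (u , π , isπ , eq) len =
    π , isπ , ++-cancelˡ-sameLength (trans len (sym (length-tabulate (lookup P ∘ π)))) eq

module _ {m : ℕ} (A : DFA m) where

  run-++ : ∀ q (x z : Word m) → run A q (x ++ z) ≡ run A (run A q x) z
  run-++ q []      z = refl
  run-++ q (c ∷ x) z = run-++ (δ A q c) x z

  sameState⇒sameResidual : ∀ {L : Word m → Set} → Recognizes A L → ∀ {x y} →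
                           run A (start A) x ≡ run A (start A) y → ∀ z → L (x ++ z) ⇔ L (y ++ z)
  sameState⇒sameResidual {L} rec {x} {y} same z = mk⇔ (transfer same) (transfer (sym same))
    where
    transfer : ∀ {x y} → run A (start A) x ≡ run A (start A) y → L (x ++ z) → L (y ++ z)
    transfer {x} {y} same Lxz = Equivalence.to (rec (y ++ z)) (begin
      final A (run A (start A) (y ++ z)) ≡⟨ cong (final A) (run-++ (start A) y z) ⟩
      final A (run A (run A (start A) y) z) ≡⟨ cong (λ q → final A (run A q z)) (sym same) ⟩
      final A (run A (run A (start A) x) z) ≡⟨ cong (final A) (sym (run-++ (start A) x z)) ⟩
      final A (run A (start A) (x ++ z)) ≡⟨ Equivalence.from (rec (x ++ z)) Lxz ⟩
      true ∎)
      where open ≡-Reasoning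

  distinguishable⇒≤nStates : ∀ {L : Word m → Set} {N} → Recognizes A L → (w : Fin N → Word m) →
                             (∀ i j → (∀ z → L (w i ++ z) ⇔ L (w j ++ z)) → i ≡ j) → N ≤ nStates A
  distinguishable⇒≤nStates rec w distinct =
    injective⇒≤ {f = run A (start A) ∘ w} λ {i} {j} same → distinct i j (sameState⇒sameResidual rec same)

funToFin-cong : ∀ {M n} {f g : Fin M → Fin n} → f ≗ g → funToFin {M} {n} f ≡ funToFin g
funToFin-cong {zero}  f≗g = refl
funToFin-cong {suc M} f≗g = cong₂ combine (f≗g zero) (funToFin-cong (f≗g ∘ suc))

finToFun-injective : ∀ {M n} {k k′ : Fin (n ^ M)} → finToFun {n} {M} k ≗ finToFun k′ → k ≡ k′
finToFun-injective {M} {n} {k} {k′} eq = begin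
  k                                ≡⟨ funToFin-finToFin {M} {n} k ⟨
  funToFin {M} {n} (finToFun k)   ≡⟨ funToFin-cong eq ⟩
  funToFin {M} {n} (finToFun k′)  ≡⟨ funToFin-finToFin {M} {n} k′ ⟩
  k′                               ∎
  where open ≡-Reasoning

a b : Fin 2
a = zero
b = suc zero

a≢b : a ≢ b
a≢b ()

ab^ : ℕ → Word 2
ab^ zero    = []
ab^ (suc k) = a ∷ b ∷ ab^ k

hardPattern : ℕ → Word 2
hardPattern M = a ∷ ab^ M

ab^-+ : ∀ j k → ab^ (j + k) ≡ ab^ j ++ ab^ k
ab^-+ zero    k = refl
ab^-+ (suc j) k = cong (λ w → a ∷ b ∷ w) (ab^-+ j k)

ab^-injective : ∀ {j k} → ab^ j ≡ ab^ k → j ≡ k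
ab^-injective {zero}  {zero}  eq = refl
ab^-injective {suc j} {suc k} eq = cong ℕ.suc (ab^-injective (∷-injectiveʳ (∷-injectiveʳ eq)))

hardPattern-injective : Injective _≡_ _≡_ hardPattern
hardPattern-injective = ab^-injective ∘ ∷-injectiveʳ

length-ab^ : ∀ k → length (ab^ k) ≡ k + k
length-ab^ zero    = refl
length-ab^ (suc k) = cong ℕ.suc (trans (cong ℕ.suc (length-ab^ k)) (sym (+-suc k k)))

block : Fin 2 → Word 2
block zero       = b ∷ a ∷ []
block (suc zero) = a ∷ b ∷ []

blocks : ∀ {M} → (Fin M → Fin 2) → Word 2
blocks {zero}  f = []
blocks {suc M} f = block (f zero) ++ blocks (f ∘ suc)

blocks-swap : ∀ {M} (f : Fin M → Fin 2) → Swap (ab^ M) (blocks f)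
blocks-swap {zero}  f = []
blocks-swap {suc M} f with f zero
... | zero     = swap a≢b (blocks-swap (f ∘ suc))
... | suc zero = keep a (keep b (blocks-swap (f ∘ suc)))

blocks-split : ∀ {M} (i : Fin M) (f : Fin M → Fin 2) →
               Σ ℕ λ r → Σ (Word 2) λ L → Σ (Fin r → Fin 2) λ g →
                 (M ≡ r + suc (toℕ i)) × (blocks f ≡ L ++ block (f i) ++ blocks g)
blocks-split {suc M} zero    f = M , [] , f ∘ suc , sym (+-comm M 1) , refl
blocks-split {suc M} (suc i) f with blocks-split i (f ∘ suc)
... | r , L , g , M≡ , eq =
  r , block (f zero) ++ L , g , trans (cong ℕ.suc M≡) (sym (+-suc r (suc (toℕ i)))) ,
  trans (cong (block (f zero) ++_) eq) (sym (++-assoc (block (f zero)) L _))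

block-a-accepted : ∀ {M} L {R} → Swap (ab^ M) R → LS (hardPattern M) (L ++ block a ++ R)
block-a-accepted {M} L {R} s =
  subst (LS (hardPattern M)) (++-assoc L [ b ] (a ∷ R)) (LS-intro (L ++ [ b ]) (keep a s))

-- The last |P| letters form b R, which is not a swapped version of P = a a b ….
block-b-rejected : ∀ {M} L {R} → Swap (ab^ (suc M)) R → ¬ LS (hardPattern (suc M)) (L ++ block b ++ R)
block-b-rejected L {R} s ls with LS-suffix (subst (LS _) (sym (++-assoc L [ a ] (b ∷ R))) ls)
                                           (cong ℕ.suc (sym (Swap-length s)))
... | π , isπ , eq = a≢b (trans (sym (swapPerm-head isπ)) (sym (∷-injectiveˡ eq)))

blocks++ab^∈LS⇔ : ∀ {M} (i : Fin M) (f : Fin M → Fin 2) →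
              LS (hardPattern M) (blocks f ++ ab^ (suc (toℕ i))) ⇔ (f i ≡ a)
blocks++ab^∈LS⇔ {suc M} i f with blocks-split i f
... | r , L , g , M≡ , eq =
  mk⇔ (accepted⇒a (f i) ∘ subst (LS _) word≡) (subst (LS _) (sym word≡) ∘ a⇒accepted)
  where
  z : Word 2
  z = ab^ (suc (toℕ i))
  R : Word 2
  R = blocks g ++ z
  word≡ : blocks f ++ z ≡ L ++ block (f i) ++ R
  word≡ = trans (cong (_++ z) eq)
            (trans (++-assoc L _ z) (cong (L ++_) (++-assoc (block (f i)) (blocks g) z)))
  swapR : Swap (ab^ (suc M)) R
  swapR = subst (λ w → Swap w R) (sym (trans (cong ab^ M≡) (ab^-+ r (suc (toℕ i)))))
            (Swap-++ (blocks-swap g) (Swap-refl z))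
  accepted⇒a : ∀ c → LS (hardPattern (suc M)) (L ++ block c ++ R) → c ≡ a
  accepted⇒a zero       _  = refl
  accepted⇒a (suc zero) ls = ⊥-elim (block-b-rejected L swapR ls)
  a⇒accepted : f i ≡ a → LS (hardPattern (suc M)) (L ++ block (f i) ++ R)
  a⇒accepted fi≡a = subst (λ c → LS _ (L ++ block c ++ R)) (sym fi≡a) (block-a-accepted L swapR)

≡-from-⇔≡a : ∀ {x y : Fin 2} → (x ≡ a ⇔ y ≡ a) → x ≡ y
≡-from-⇔≡a {zero}     {zero}     _  = refl
≡-from-⇔≡a {zero}     {suc zero} ⇔a = sym (Equivalence.to ⇔a refl)
≡-from-⇔≡a {suc zero} {zero}     ⇔a = Equivalence.from ⇔a refl
≡-from-⇔≡a {suc zero} {suc zero} _  = refl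

suc[M+M]≤M*3 : ∀ {M} → 1 ≤ M → suc (M + M) ≤ M * 3
suc[M+M]≤M*3 {M} 1≤M = begin
  suc (M + M)        ≤⟨ +-monoˡ-≤ (M + M) 1≤M ⟩
  M + (M + M)        ≡⟨ cong (λ n → M + (M + n)) (sym (+-identityʳ M)) ⟩
  3 * M              ≡⟨ *-comm 3 M ⟩
  M * 3              ∎
  where open ≤-Reasoning

hardPattern-bound : ∀ M (A : DFA 2) → Recognizes A (LS (hardPattern M)) → 2 ^ M ≤ nStates A
hardPattern-bound M A rec = distinguishable⇒≤nStates A rec (blocks ∘ finToFun {2} {M}) λ k k′ sameResidual →
  finToFun-injective {M} λ i → ≡-from-⇔≡a
    (blocks++ab^∈LS⇔ i (finToFun k′) ⇔-∘ (sameResidual (ab^ (suc (toℕ i))) ⇔-∘ ⇔-sym (blocks++ab^∈LS⇔ i (finToFun k))))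

theorem3 : Σ ℕ λ m → Σ (ℕ → Word m) λ F → Injective _≡_ _≡_ F ×
    (Σ ℕ λ k → Σ ℕ λ n₀ → ∀ i → n₀ ≤ length (F i) → (A : DFA m) → Recognizes A (LS (F i)) →
    2 ^ length (F i) ≤ nStates A ^ suc k)
theorem3 = 2 , hardPattern ∘ suc , suc-injective ∘ hardPattern-injective , 2 , 0 , λ i _ A rec →
  let M = suc i; open ≤-Reasoning in begin
    2 ^ length (hardPattern M)  ≡⟨ cong (λ n → 2 ^ suc n) (length-ab^ M) ⟩
    2 ^ suc (M + M)             ≤⟨ ^-monoʳ-≤ 2 (suc[M+M]≤M*3 {M} (s≤s z≤n)) ⟩
    2 ^ (M * 3)                 ≡⟨ ^-*-assoc 2 M 3 ⟨
    (2 ^ M) ^ 3                 ≤⟨ ^-monoˡ-≤ 3 (hardPattern-bound M A rec) ⟩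
    nStates A ^ 3               ∎
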